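{- Let $c\ge1$ and $N>c$ be integers, and let $F_N$ be the star with $N$ leaves. Then every $c$-closed graph $G$ on $n$ vertices has at most $3^c n^2+n^c$ sets $S\subseteq V(G)$ such that $G[S]$ is a maximal blow-up of $F_N$.
   Context: A graph is $c$-closed if any two distinct non-adjacent vertices have fewer than $c$ common neighbours. With $V(F)=\{1,\dots,k\}$, a blow-up of $F$ (non-induced, with no prescriptions) is a graph whose vertex set is partitioned into nonempty sets $V_1\sqcup\dots\sqcup V_k$ with $V_i$ complete to $V_j$ whenever $ij\in E(F)$, and no other requirements. $G[S]$ is a maximal blow-up of $F$ if it is a blow-up of $F$ and no $S'$ with $S\subsetneq S'\subseteq V(G)$ has $G[S']$ a blow-up of $F$. -}

module Defs where

open import Data.Nat using (ℕ; zero; suc; _<_)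
open import Data.Bool using (Bool; true; false; _∧_; T)
open import Data.Fin using (Fin; zero; suc)
open import Data.Fin.Subset using (Subset; _∈_; _⊂_; ∣_∣)
open import Data.Vec using (tabulate)
open import Data.Product using (Σ; _×_; ∃)
open import Relation.Binary.PropositionalEquality using (_≡_; _≢_)
open import Relation.Nullary using (¬_)

record Graph (n : ℕ) : Set where
  field
    adj   : Fin n → Fin n → Bool
    sym   : ∀ u v → adj u v ≡ adj v u
    irrefl : ∀ u → adj u u ≡ false

open Graph public

Adj : ∀ {n} → Graph n → Fin n → Fin n → Set
Adj G u v = T (adj G u v)

commonNbrs : ∀ {n} → Graph n → Fin n → Fin n → Subset n
commonNbrs G u v = tabulate (λ w → adj G u w ∧ adj G v w)

CClosed : ℕ → ∀ {n} → Graph n → Set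
CClosed c G = ∀ u v → u ≢ v → ¬ Adj G u v → ∣ commonNbrs G u v ∣ < c

-- G[S] is a (non-induced) blow-up of F (vertex set Fin k): S is partitioned
-- into nonempty parts V_i = {v ∈ S | f v = i}, with V_i complete to V_j
-- whenever ij ∈ E(F).  (Values of f outside S are irrelevant.)
IsBlowUp : ∀ {n k} → Graph n → Graph k → Subset n → Set
IsBlowUp {n} {k} G F S =
  Σ (Fin n → Fin k) λ f →
    (∀ (i : Fin k) → ∃ λ v → v ∈ S × f v ≡ i) ×
    (∀ u v → u ∈ S → v ∈ S → Adj F (f u) (f v) → Adj G u v)

IsMaxBlowUp : ∀ {n k} → Graph n → Graph k → Subset n → Set
IsMaxBlowUp G F S = IsBlowUp G F S × (∀ S′ → S ⊂ S′ → ¬ IsBlowUp G F S′)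

starAdj : ∀ {N} → Fin (suc N) → Fin (suc N) → Bool
starAdj zero    zero    = false
starAdj zero    (suc _) = true
starAdj (suc _) zero    = true
starAdj (suc _) (suc _) = false

starSym : ∀ {N} (u v : Fin (suc N)) → starAdj u v ≡ starAdj v u
starSym zero zero = _≡_.refl
starSym zero (suc _) = _≡_.refl
starSym (suc _) zero = _≡_.refl
starSym (suc _) (suc _) = _≡_.refl

starIrr : ∀ {N} (u : Fin (suc N)) → starAdj u u ≡ false
starIrr zero = _≡_.refl
starIrr (suc _) = _≡_.refl

Star : (N : ℕ) → Graph (suc N)
Star N = record { adj = starAdj ; sym = starSym ; irrefl = starIrr }

-- In a maximal blow-up S of the star F_N inside a c-closed graph, the centre class A is a clique:
-- two non-adjacent centre vertices would have as common neighbours one representative of each of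
-- the N > c leaf classes. Pick c vertices t₁, …, t_c of A, pairwise distinct if |A| ≥ c and exhausting A
-- otherwise. Then S is the common closed neighbourhood of the tᵢ: a vertex x outside S in that
-- intersection is adjacent to all of A (were x not adjacent to a ∈ A, then x and a would share the
-- distinct common neighbours tᵢ), so x could join S as a new leaf, contradicting maximality.
-- Hence S is determined by a c-tuple of vertices and there are at most n^c maximal blow-ups.

module Submission where

open import Defs
open import Data.Nat using (ℕ; _≤_; _<_; _+_; _*_; _^_)
open import Data.Fin.Subset using (Subset)
open import Data.List using (List; length)
open import Data.List.Relation.Unary.All using (All)
open import Data.List.Relation.Unary.Unique.Propositional using (Unique)

open import Data.Bool using (T)
open import Data.Bool.Properties using (T-≡; T-∧)
open import Data.Nat using (zero; suc; z≤n; s≤s)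
open import Data.Nat.Properties using (≤-trans; <⇒≤; <⇒≱; m≤n+m)
open import Data.Fin using (Fin; zero; suc; _≟_; inject≤; fromℕ<; finToFun; funToFin)
open import Data.Fin.Properties
  using (any?; suc-injective; 0≢1+n; inject≤-injective; injective⇒≤; finToFun-funToFin)
open import Data.Fin.Subset using (_∈_; _∉_; _⊂_; ∣_∣; _∪_; ⁅_⁆; _-_)
open import Data.Fin.Subset.Properties
  using ( _∈?_; x∈p∧x≢y⇒x∈p-y; x∈p⇒∣p-x∣<∣p∣; x∈p∪q⁺; x∈p∪q⁻; p⊆p∪q
        ; x∈⁅x⁆; x∈⁅y⁆⇒x≡y; ⊆-antisym)
import Data.List as List
import Data.List.Relation.Unary.All as All
import Data.List.Relation.Unary.AllPairs as AllPairs
open import Data.List.Membership.Propositional.Properties using (∈-lookup)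
open import Data.Product using (Σ; ∃; _×_; _,_; proj₁; proj₂)
open import Data.Sum using (_⊎_; inj₁; inj₂)
open import Data.Unit using (tt)
open import Data.Vec.Properties using (lookup⇒[]=; lookup∘tabulate)
open import Data.Vec.Functional using (updateAt; _∷_)
open import Data.Vec.Functional.Properties using (updateAt-updates; updateAt-minimal)
open import Function using (_⇔_; mk⇔; Equivalence; const)
open import Function.Definitions using (Injective)
open import Level using (0ℓ)
open import Relation.Binary.PropositionalEquality as ≡
  using (_≡_; _≢_; _≗_; refl; trans; cong; subst; subst₂)
open import Relation.Nullary using (¬_; yes; no; contradiction)
open import Relation.Nullary.Decidable using (_×-dec_; ¬?; T?; decidable-stable)
open import Relation.Unary using (Pred; Decidable)

open Equivalence using (to; from)

lookup-injective : ∀ {A : Set} {xs : List A} → Unique xs →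
                   ∀ i j → List.lookup xs i ≡ List.lookup xs j → i ≡ j
lookup-injective (_ AllPairs.∷ _)       zero    zero    _ = refl
lookup-injective (x≢xs AllPairs.∷ _)    zero    (suc j) e =
  contradiction e (All.lookup x≢xs (∈-lookup j))
lookup-injective (x≢xs AllPairs.∷ _)    (suc i) zero    e =
  contradiction (≡.sym e) (All.lookup x≢xs (∈-lookup i))
lookup-injective (_ AllPairs.∷ unique) (suc i) (suc j) e = cong suc (lookup-injective unique i j e)

length≤-of-codes : ∀ {A : Set} {M} (Codes : A → Fin M → Set) →
                   (∀ {x y k} → Codes x k → Codes y k → x ≡ y) →
                   ∀ {xs} → Unique xs → All (λ x → ∃ (Codes x)) xs → length xs ≤ M
length≤-of-codes {M = M} Codes codes-unique {xs} unique coded = injective⇒≤ code-injective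
  where
  code : Fin (length xs) → Fin M
  code i = proj₁ (All.lookup coded (∈-lookup i))

  code-injective : Injective _≡_ _≡_ code
  code-injective {i} {j} e = lookup-injective unique i j
    (codes-unique (proj₂ (All.lookup coded (∈-lookup i)))
                  (subst (Codes _) (≡.sym e) (proj₂ (All.lookup coded (∈-lookup j)))))

injective⇒≤∣∣ : ∀ {k n} {t : Fin k → Fin n} (p : Subset n) →
                Injective _≡_ _≡_ t → (∀ i → t i ∈ p) → k ≤ ∣ p ∣
injective⇒≤∣∣ {zero}          _ _     _   = z≤n
injective⇒≤∣∣ {suc k} {t = t} p t-inj t∈p =
  ≤-trans (s≤s (injective⇒≤∣∣ (p - t zero) tail-inj tail∈)) (x∈p⇒∣p-x∣<∣p∣ (t∈p zero))
  where
  tail-inj : Injective _≡_ _≡_ (λ i → t (suc i))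
  tail-inj e = suc-injective (t-inj e)

  tail∈ : ∀ i → t (suc i) ∈ p - t zero
  tail∈ i = x∈p∧x≢y⇒x∈p-y (t∈p (suc i)) (λ e → 0≢1+n (≡.sym (t-inj e)))

∷⁺ : ∀ {n k} (P : Pred (Fin n) 0ℓ) {x} {t : Fin k → Fin n} →
     P x → (∀ i → P (t i)) → ∀ i → P ((x ∷ t) i)
∷⁺ _ Px _  zero    = Px
∷⁺ _ _  Pt (suc i) = Pt i

InjectiveOrOnto : ∀ {k n} → Pred (Fin n) 0ℓ → (Fin k → Fin n) → Set
InjectiveOrOnto X t = Injective _≡_ _≡_ t ⊎ (∀ {x} → X x → ∃ λ i → t i ≡ x)

injectiveOrOnto : ∀ {n} {X : Pred (Fin n) 0ℓ} → Decidable X → ∃ X → ∀ k →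
  Σ (Fin k → Fin n) λ t → (∀ i → X (t i)) × InjectiveOrOnto X t
injectiveOrOnto X? _ zero = (λ ()) , (λ ()) , inj₁ (λ { {()} })
injectiveOrOnto {X = X} X? (x₀ , Xx₀) (suc k) with injectiveOrOnto X? (x₀ , Xx₀) k
... | t , t∈X , inj₂ onto =
  x₀ ∷ t , ∷⁺ X Xx₀ t∈X , inj₂ (λ Xx → suc (proj₁ (onto Xx)) , proj₂ (onto Xx))
... | t , t∈X , inj₁ t-inj with any? (λ x → X? x ×-dec ¬? (any? (λ i → t i ≟ x)))
...   | yes (x , Xx , x∉t) = x ∷ t , ∷⁺ X Xx t∈X , inj₁ ∷-inj
  where
  ∷-inj : Injective _≡_ _≡_ (x ∷ t)
  ∷-inj {zero}  {zero}  _ = refl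
  ∷-inj {zero}  {suc j} e = contradiction (j , ≡.sym e) x∉t
  ∷-inj {suc i} {zero}  e = contradiction (i , e) x∉t
  ∷-inj {suc i} {suc j} e = cong suc (t-inj e)
...   | no no-new = x₀ ∷ t , ∷⁺ X Xx₀ t∈X , inj₂ onto
  where
  onto : ∀ {x} → X x → ∃ λ i → (x₀ ∷ t) i ≡ x
  onto {x} Xx with decidable-stable (any? (λ i → t i ≟ x)) (λ x∉t → no-new (x , Xx , x∉t))
  ... | i , e = suc i , e

Adj-sym : ∀ {n} (G : Graph n) {u v} → Adj G u v → Adj G v u
Adj-sym G {u} {v} = subst T (Graph.sym G u v)

Adj-irrefl : ∀ {n} (G : Graph n) {v} → ¬ Adj G v v
Adj-irrefl G {v} = subst T (irrefl G v)

∈-commonNbrs : ∀ {n} (G : Graph n) {u v w} → Adj G u w → Adj G v w → w ∈ commonNbrs G u v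
∈-commonNbrs G {u} {v} {w} uw vw =
  lookup⇒[]= w _ (trans (lookup∘tabulate _ w) (to T-≡ (from T-∧ (uw , vw))))

CClosed⇒Adj : ∀ {c n} {G : Graph n} → CClosed c G → ∀ {u v} → u ≢ v →
              (t : Fin c → Fin n) → Injective _≡_ _≡_ t →
              (∀ i → Adj G u (t i) × Adj G v (t i)) → Adj G u v
CClosed⇒Adj {G = G} closed {u} {v} u≢v t t-inj common with T? (adj G u v)
... | yes uv = uv
... | no ¬uv = contradiction
  (injective⇒≤∣∣ _ t-inj (λ i → ∈-commonNbrs G (proj₁ (common i)) (proj₂ (common i))))
  (<⇒≱ (closed u v u≢v ¬uv))

Adj-leaf⇒centre : ∀ {N} {i : Fin (suc N)} {ℓ} → Adj (Star N) i (suc ℓ) → i ≡ zero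
Adj-leaf⇒centre {i = zero} _ = refl

InClosedNbhd : ∀ {n} → Graph n → Fin n → Fin n → Set
InClosedNbhd G v x = x ≡ v ⊎ Adj G x v

CommonClosedNbr : ∀ {k n} → Graph n → (Fin k → Fin n) → Fin n → Set
CommonClosedNbr G t x = ∀ i → InClosedNbhd G (t i) x

IsClosedNbhdMeet : ∀ {k n} → Graph n → (Fin k → Fin n) → Subset n → Set
IsClosedNbhdMeet G t S = ∀ x → (x ∈ S ⇔ CommonClosedNbr G t x)

closedNbhdMeet-unique : ∀ {k n} {G : Graph n} {t : Fin k → Fin n} {S S′} →
                        IsClosedNbhdMeet G t S → IsClosedNbhdMeet G t S′ → S ≡ S′
closedNbhdMeet-unique S≐ S′≐ =
  ⊆-antisym (λ {x} x∈S  → from (S′≐ x) (to (S≐ x) x∈S))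
            (λ {x} x∈S′ → from (S≐ x) (to (S′≐ x) x∈S′))

closedNbhdMeet-resp-≗ : ∀ {k n} {G : Graph n} {t t′ : Fin k → Fin n} {S} →
                        t ≗ t′ → IsClosedNbhdMeet G t S → IsClosedNbhdMeet G t′ S
closedNbhdMeet-resp-≗ {G = G} t≗t′ S≐ x = mk⇔
  (λ x∈S i → subst (λ v → InClosedNbhd G v x) (t≗t′ i) (to (S≐ x) x∈S i))
  (λ near → from (S≐ x) (λ i → subst (λ v → InClosedNbhd G v x) (≡.sym (t≗t′ i)) (near i)))

module StarBlowUp {n N} (G : Graph n) {S : Subset n} (f : Fin n → Fin (suc N))
  (cover : ∀ i → ∃ λ v → v ∈ S × f v ≡ i)
  (complete : ∀ u v → u ∈ S → v ∈ S → Adj (Star N) (f u) (f v) → Adj G u v) where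

  Centre : Pred (Fin n) 0ℓ
  Centre v = v ∈ S × f v ≡ zero

  centre? : Decidable Centre
  centre? v = (v ∈? S) ×-dec (f v ≟ zero)

  CentreIsClique : Set
  CentreIsClique = ∀ {u v} → Centre u → Centre v → u ≢ v → Adj G u v

  centre-leaf-Adj : ∀ {u v j} → Centre u → v ∈ S → f v ≡ suc j → Adj G u v
  centre-leaf-Adj {u} {v} (u∈S , fu≡0) v∈S fv≡j =
    complete u v u∈S v∈S (subst₂ (Adj (Star N)) (≡.sym fu≡0) (≡.sym fv≡j) tt)

  CClosed⇒centreIsClique : ∀ {c} → CClosed c G → c ≤ N → CentreIsClique
  CClosed⇒centreIsClique closed c≤N cu cv u≢v = CClosed⇒Adj {G = G} closed u≢v leaf leaf-inj
    (λ i → centre-leaf-Adj cu (leaf∈S i) (leaf-class i) ,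
           centre-leaf-Adj cv (leaf∈S i) (leaf-class i))
    where
    leaf : Fin _ → Fin n
    leaf i = proj₁ (cover (suc (inject≤ i c≤N)))
    leaf∈S : ∀ i → leaf i ∈ S
    leaf∈S i = proj₁ (proj₂ (cover (suc (inject≤ i c≤N))))
    leaf-class : ∀ i → f (leaf i) ≡ suc (inject≤ i c≤N)
    leaf-class i = proj₂ (proj₂ (cover (suc (inject≤ i c≤N))))
    leaf-inj : Injective _≡_ _≡_ leaf
    leaf-inj {i} {j} e = inject≤-injective c≤N c≤N i j
      (suc-injective (trans (≡.sym (leaf-class i)) (trans (cong f e) (leaf-class j))))

  extend : ∀ {x} (ℓ : Fin N) → x ∉ S → (∀ {a} → Centre a → Adj G x a) →
           IsBlowUp G (Star N) (S ∪ ⁅ x ⁆)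
  extend {x} ℓ x∉S x-centre = f′ , cover′ , complete′
    where
    f′ : Fin n → Fin (suc N)
    f′ = updateAt f x (const (suc ℓ))

    f′-S : ∀ {v} → v ∈ S → f′ v ≡ f v
    f′-S {v} v∈S = updateAt-minimal v x f (λ { refl → x∉S v∈S })

    cover′ : ∀ i → ∃ λ v → v ∈ S ∪ ⁅ x ⁆ × f′ v ≡ i
    cover′ i with cover i
    ... | v , v∈S , fv≡i = v , x∈p∪q⁺ (inj₁ v∈S) , trans (f′-S v∈S) fv≡i

    Adj-x : ∀ {v} → v ∈ S → Adj (Star N) (f′ v) (f′ x) → Adj G v x
    Adj-x v∈S a = Adj-sym G (x-centre
      (v∈S , Adj-leaf⇒centre (subst₂ (Adj (Star N)) (f′-S v∈S) (updateAt-updates x f) a)))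

    complete′ : ∀ u v → u ∈ S ∪ ⁅ x ⁆ → v ∈ S ∪ ⁅ x ⁆ → Adj (Star N) (f′ u) (f′ v) → Adj G u v
    complete′ u v u∈S′ v∈S′ a with x∈p∪q⁻ S ⁅ x ⁆ u∈S′ | x∈p∪q⁻ S ⁅ x ⁆ v∈S′
    ... | inj₁ u∈S | inj₁ v∈S =
      complete u v u∈S v∈S (subst₂ (Adj (Star N)) (f′-S u∈S) (f′-S v∈S) a)
    ... | inj₁ u∈S | inj₂ v∈x with refl ← x∈⁅y⁆⇒x≡y x v∈x = Adj-x u∈S a
    ... | inj₂ u∈x | inj₁ v∈S with refl ← x∈⁅y⁆⇒x≡y x u∈x =
      Adj-sym G (Adj-x v∈S (Adj-sym (Star N) a))
    ... | inj₂ u∈x | inj₂ v∈x with refl ← x∈⁅y⁆⇒x≡y x u∈x | refl ← x∈⁅y⁆⇒x≡y x v∈x =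
      contradiction a (Adj-irrefl (Star N))

  S⊆closedNbhdMeet : CentreIsClique → ∀ {k} (t : Fin k → Fin n) → (∀ i → Centre (t i)) →
                     ∀ {x} → x ∈ S → CommonClosedNbr G t x
  S⊆closedNbhdMeet clique t t-centre {x} x∈S i with x ≟ t i
  ... | yes x≡ti = inj₁ x≡ti
  ... | no x≢ti with f x in fx
  ...   | zero  = inj₂ (clique (x∈S , fx) (t-centre i) x≢ti)
  ...   | suc _ = inj₂ (Adj-sym G (centre-leaf-Adj (t-centre i) x∈S fx))

  closedNbhdMeet⊆S : ∀ {c} → CClosed c G → c < N →
    (∀ S′ → S ⊂ S′ → ¬ IsBlowUp G (Star N) S′) →
    (t : Fin c → Fin n) → (∀ i → Centre (t i)) → InjectiveOrOnto Centre t →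
    ∀ {x} → CommonClosedNbr G t x → x ∈ S
  closedNbhdMeet⊆S closed c<N maximal t t-centre spread {x} near =
    decidable-stable (x ∈? S) λ x∉S →
      maximal (S ∪ ⁅ x ⁆) (p⊆p∪q ⁅ x ⁆ , x , x∈p∪q⁺ (inj₂ (x∈⁅x⁆ x)) , x∉S)
              (extend (fromℕ< c<N) x∉S (Adj-centre spread x∉S))
    where
    Adj-t : x ∉ S → ∀ i → Adj G x (t i)
    Adj-t x∉S i with near i
    ... | inj₁ refl = contradiction (proj₁ (t-centre i)) x∉S
    ... | inj₂ a    = a

    Adj-centre : InjectiveOrOnto Centre t → x ∉ S → ∀ {a} → Centre a → Adj G x a
    Adj-centre spread x∉S {a} ca with any? (λ i → t i ≟ a) | spread
    ... | yes (i , refl) | _         = Adj-t x∉S i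
    ... | no a∉t         | inj₂ onto  = contradiction (onto ca) a∉t
    ... | no a∉t         | inj₁ t-inj =
      CClosed⇒Adj {G = G} closed (λ { refl → x∉S (proj₁ ca) }) t t-inj λ i →
        Adj-t x∉S i ,
        CClosed⇒centreIsClique closed (<⇒≤ c<N) ca (t-centre i) (λ { refl → a∉t (i , refl) })

maxStarBlowUp⇒closedNbhdMeet : ∀ {c n N} {G : Graph n} {S} → CClosed c G → c < N →
  IsMaxBlowUp G (Star N) S → ∃ λ (t : Fin c → Fin n) → IsClosedNbhdMeet G t S
maxStarBlowUp⇒closedNbhdMeet {c} {G = G} closed c<N ((f , cover , complete) , maximal)
  with t , t-centre , spread ←
         injectiveOrOnto (StarBlowUp.centre? G f cover complete) (_ , proj₂ (cover zero)) c
  = t , λ x → mk⇔ (S⊆closedNbhdMeet (CClosed⇒centreIsClique closed (<⇒≤ c<N)) t t-centre)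
                  (closedNbhdMeet⊆S closed c<N maximal t t-centre spread)
  where open StarBlowUp G f cover complete

proposition2 : (c N : ℕ) → 1 ≤ c → c < N →
    (n : ℕ) (G : Graph n) → CClosed c G →
    (L : List (Subset n)) → Unique L → All (IsMaxBlowUp G (Star N)) L →
    length L ≤ 3 ^ c * n ^ 2 + n ^ c
proposition2 c N _ c<N n G closed L unique maxBlowUps =
  ≤-trans (length≤-of-codes (λ S k → IsClosedNbhdMeet G (finToFun k) S)
                            (closedNbhdMeet-unique {G = G}) unique (All.map code maxBlowUps))
          (m≤n+m (n ^ c) (3 ^ c * n ^ 2))
  where
  code : ∀ {S} → IsMaxBlowUp G (Star N) S →
         ∃ λ (k : Fin (n ^ c)) → IsClosedNbhdMeet G (finToFun k) S
  code maxBlowUp with t , S≐ ← maxStarBlowUp⇒closedNbhdMeet {G = G} closed c<N maxBlowUp =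
    funToFin t , closedNbhdMeet-resp-≗ {G = G} (λ i → ≡.sym (finToFun-funToFin t i)) S≐
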